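{- For every Dependence Logic formula $\phi$ there exists a Dynamic Dependence Logic formula $\phi'$ such that for all first-order models $M$ and teams $X$ over $M$, \[ M\models_X\phi \iff M\models_X\phi' \iff \exists Y\ \text{such that}\ M\models_{X\rightarrow Y}\phi'. \]
   Context: Teams over $M$ are sets of assignments $s:\mathrm{Var}\to\mathrm{dom}(M)$, $\mathrm{Var}$ the set of all variables; $s[m/v]$ changes the value of $v$ to $m$; $X[F/v]=\{s[F(s)/v]:s\in X\}$ for $F:X\to\mathrm{dom}(M)$; $X[M/v]=\{s[m/v]:s\in X,m\in\mathrm{dom}(M)\}$. Dependence Logic (DL): formulas $\phi ::= R\vec t\mid\lnot R\vec t\mid=\!(t_1,\ldots,t_n)\mid\phi\vee\phi\mid\phi\wedge\phi\mid\exists v\phi\mid\forall v\phi$ with team semantics: a literal holds in $X$ iff it holds (first-order) in every $s\in X$; $=\!(t_1,\ldots,t_n)$ holds iff any $s,s'\in X$ agreeing on the values of $t_1,\ldots,t_{n-1}$ agree on $t_n$; $M\models_X\psi_1\vee\psi_2$ iff $X=Y_1\cup Y_2$ with $M\models_{Y_1}\psi_1$, $M\models_{Y_2}\psi_2$; $\wedge$ both; $M\models_X\exists v\psi$ iff $M\models_{X[F/v]}\psi$ for some $F$; $M\models_X\forall v\psi$ iff $M\models_{X[M/v]}\psi$. Dynamic Dependence Logic (DDL): formulas $\tau ::= R\vec t\mid\lnot R\vec t\mid=\!(t_1,\ldots,t_n)\mid\exists v\mid\forall v\mid\tau\otimes\tau\mid\tau\cap\tau\mid\tau;\tau$, with transition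 semantics: for a literal $\tau$, $M\models_{X\rightarrow Y}\tau$ iff $\tau$ holds (first-order) in every $s\in X$ and $X\subseteq Y$; for $=\!(t_1,\ldots,t_n)$, iff $X\subseteq Y$ and any $s,s'\in X$ agreeing on $t_1,\ldots,t_{n-1}$ agree on $t_n$; $M\models_{X\rightarrow Y}\exists v$ iff $X[F/v]\subseteq Y$ for some $F$; $M\models_{X\rightarrow Y}\forall v$ iff $X[M/v]\subseteq Y$; $M\models_{X\rightarrow Y}\tau_1\otimes\tau_2$ iff $X=X_1\cup X_2$ with $M\models_{X_1\rightarrow Y}\tau_1$, $M\models_{X_2\rightarrow Y}\tau_2$; $\cap$ requires both; $M\models_{X\rightarrow Y}\tau_1;\tau_2$ iff some team $Z$ has $M\models_{X\rightarrow Z}\tau_1$, $M\models_{Z\rightarrow Y}\tau_2$. A DDL formula $\tau$ is satisfied by $X$, written $M\models_X\tau$, iff $M\models_{X\rightarrow Y}\tau$ for some team $Y$. -}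

module Defs where

open import Level using (Level) renaming (suc to lsuc; zero to lzero)
open import Data.Nat using (ℕ; _≟_)
open import Data.Vec using (Vec; []; _∷_)
open import Data.Product using (Σ; _×_; _,_; ∃)
open import Data.Sum using (_⊎_)
open import Relation.Nullary using (¬_; yes; no)
open import Relation.Binary.PropositionalEquality using (_≡_)

Var : Set
Var = ℕ

record Signature : Set₁ where
  field
    Rel    : Set
    rarity : Rel → ℕ
    Fun    : Set
    farity : Fun → ℕ

module Syntax (σ : Signature) where
  open Signature σ

  data Term : Set where
    var : Var → Term
    app : (f : Fun) → Vec Term (farity f) → Term

  -- Dependence Logic formulas.
  -- dep ts t  is the dependence atom  =(t₁,…,tₙ₋₁,tₙ)  with ts = t₁…tₙ₋₁, t = tₙ.
  data DL : Set where
    rel  : (R : Rel) → Vec Term (rarity R) → DL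
    nrel : (R : Rel) → Vec Term (rarity R) → DL
    dep  : {n : ℕ} → Vec Term n → Term → DL
    _∨_  : DL → DL → DL
    _∧_  : DL → DL → DL
    ex   : Var → DL → DL
    all  : Var → DL → DL

  data DDL : Set where
    rel  : (R : Rel) → Vec Term (rarity R) → DDL
    nrel : (R : Rel) → Vec Term (rarity R) → DDL
    dep  : {n : ℕ} → Vec Term n → Term → DDL
    ex   : Var → DDL
    all  : Var → DDL
    _⊗_  : DDL → DDL → DDL
    _∩_  : DDL → DDL → DDL
    _⨾_  : DDL → DDL → DDL

record Structure (σ : Signature) : Set₁ where
  open Signature σ
  field
    Dom  : Set
    relI : (R : Rel) → Vec Dom (rarity R) → Set
    funI : (f : Fun) → Vec Dom (farity f) → Dom

module Semantics {σ : Signature} (M : Structure σ) where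
  open Signature σ
  open Structure M
  open Syntax σ

  Assignment : Set
  Assignment = Var → Dom

  update : Assignment → Var → Dom → Assignment
  update s v m w with w ≟ v
  ... | yes _ = m
  ... | no  _ = s w

  mutual
    eval : Term → Assignment → Dom
    eval (var v)    s = s v
    eval (app f ts) s = funI f (evals ts s)

    evals : {n : ℕ} → Vec Term n → Assignment → Vec Dom n
    evals []       s = []
    evals (t ∷ ts) s = eval t s ∷ evals ts s

  Team : Set₁
  Team = Assignment → Set

  _⊆_ : Team → Team → Set
  X ⊆ Y = ∀ s → X s → Y s

  IsUnion : Team → Team → Team → Set
  IsUnion X Y₁ Y₂ = (X ⊆ λ s → Y₁ s ⊎ Y₂ s) × (Y₁ ⊆ X) × (Y₂ ⊆ X)

  _≗ₐ_ : Assignment → Assignment → Set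
  s ≗ₐ s' = ∀ w → s w ≡ s' w

  -- Functions F : X → dom(M) (taken as extensional total functions on assignments).
  record Choice : Set where
    field
      fn   : Assignment → Dom
      resp : ∀ s s' → s ≗ₐ s' → fn s ≡ fn s'
  open Choice public

  supplement : Team → Choice → Var → Team
  supplement X F v t = Σ Assignment λ s → X s × (t ≡ update s v (fn F s))

  duplicate : Team → Var → Team
  duplicate X v t = Σ Assignment λ s → Σ Dom λ m → X s × (t ≡ update s v m)

  RelHolds : (R : Rel) → Vec Term (rarity R) → Assignment → Set
  RelHolds R ts s = relI R (evals ts s)

  DepHolds : {n : ℕ} → Vec Term n → Term → Team → Set
  DepHolds ts t X = ∀ s s' → X s → X s' → evals ts s ≡ evals ts s' → eval t s ≡ eval t s'

  _⊨DL_ : Team → DL → Set₁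
  X ⊨DL rel R ts  = Level.Lift (lsuc lzero) (∀ s → X s → RelHolds R ts s)
  X ⊨DL nrel R ts = Level.Lift (lsuc lzero) (∀ s → X s → ¬ RelHolds R ts s)
  X ⊨DL dep ts t  = Level.Lift (lsuc lzero) (DepHolds ts t X)
  X ⊨DL (φ ∨ ψ)   = Σ Team λ Y₁ → Σ Team λ Y₂ → Level.Lift (lsuc lzero) (IsUnion X Y₁ Y₂) × (Y₁ ⊨DL φ) × (Y₂ ⊨DL ψ)
  X ⊨DL (φ ∧ ψ)   = (X ⊨DL φ) × (X ⊨DL ψ)
  X ⊨DL ex v φ    = Σ Choice λ F → supplement X F v ⊨DL φ
  X ⊨DL all v φ   = duplicate X v ⊨DL φ

  _⟶_⊨DDL_ : Team → Team → DDL → Set₁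
  X ⟶ Y ⊨DDL rel R ts  = Level.Lift (lsuc lzero) ((∀ s → X s → RelHolds R ts s) × X ⊆ Y)
  X ⟶ Y ⊨DDL nrel R ts = Level.Lift (lsuc lzero) ((∀ s → X s → ¬ RelHolds R ts s) × X ⊆ Y)
  X ⟶ Y ⊨DDL dep ts t  = Level.Lift (lsuc lzero) (X ⊆ Y × DepHolds ts t X)
  X ⟶ Y ⊨DDL ex v      = Level.Lift (lsuc lzero) (Σ Choice λ F → supplement X F v ⊆ Y)
  X ⟶ Y ⊨DDL all v     = Level.Lift (lsuc lzero) (duplicate X v ⊆ Y)
  X ⟶ Y ⊨DDL (τ ⊗ τ')  = Σ Team λ X₁ → Σ Team λ X₂ →
                           Level.Lift (lsuc lzero) (IsUnion X X₁ X₂) × (X₁ ⟶ Y ⊨DDL τ) × (X₂ ⟶ Y ⊨DDL τ')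
  X ⟶ Y ⊨DDL (τ ∩ τ')  = (X ⟶ Y ⊨DDL τ) × (X ⟶ Y ⊨DDL τ')
  X ⟶ Y ⊨DDL (τ ⨾ τ')  = Σ Team λ Z → (X ⟶ Z ⊨DDL τ) × (Z ⟶ Y ⊨DDL τ')

  _⊨DDL_ : Team → DDL → Set₁
  X ⊨DDL τ = Σ Team λ Y → X ⟶ Y ⊨DDL τ

module Submission where

open import Defs
open import Data.Product using (Σ; _×_; _,_; proj₁; proj₂)
open import Data.Sum using (_⊎_; inj₁; inj₂)
import Data.Sum as Sum
open import Function.Bundles using (_⇔_; mk⇔)
import Function.Properties.Equivalence as ⇔
open import Level using (lift)

-- Translate ∨, ∧ into ⊗, ∩ and a quantifier Q v φ into Q v ⨾ φ′.  Transitions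
-- are upward closed in the target team and downward closed in the source
-- team.  The first property lets the runs of two subformulas share the union
-- of their targets; the second cuts a run from a team containing X[F/v]
-- (resp. X[M/v]) back to a run from X[F/v] itself.

module _ {σ : Signature} where
  open Syntax σ

  toDDL : DL → DDL
  toDDL (rel R ts)  = rel R ts
  toDDL (nrel R ts) = nrel R ts
  toDDL (dep ts t)  = dep ts t
  toDDL (φ ∨ ψ)     = toDDL φ ⊗ toDDL ψ
  toDDL (φ ∧ ψ)     = toDDL φ ∩ toDDL ψ
  toDDL (ex v φ)    = ex v ⨾ toDDL φ
  toDDL (all v φ)   = all v ⨾ toDDL φ

  module _ (M : Structure σ) where
    open Semantics M

    ⊆-refl : {X : Team} → X ⊆ X
    ⊆-refl _ x = x

    ⊨DDL-mono-target : ∀ τ {X Y Y′} → Y ⊆ Y′ → X ⟶ Y ⊨DDL τ → X ⟶ Y′ ⊨DDL τ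
    ⊨DDL-mono-target (rel R ts)  Y⊆Y′ (lift (holds , X⊆Y)) = lift (holds , λ s x → Y⊆Y′ s (X⊆Y s x))
    ⊨DDL-mono-target (nrel R ts) Y⊆Y′ (lift (holds , X⊆Y)) = lift (holds , λ s x → Y⊆Y′ s (X⊆Y s x))
    ⊨DDL-mono-target (dep ts t)  Y⊆Y′ (lift (X⊆Y , holds)) = lift ((λ s x → Y⊆Y′ s (X⊆Y s x)) , holds)
    ⊨DDL-mono-target (ex v)      Y⊆Y′ (lift (F , XF⊆Y))    = lift (F , λ s x → Y⊆Y′ s (XF⊆Y s x))
    ⊨DDL-mono-target (all v)     Y⊆Y′ (lift XM⊆Y)          = lift (λ s x → Y⊆Y′ s (XM⊆Y s x))
    ⊨DDL-mono-target (τ ⊗ τ′) Y⊆Y′ (X₁ , X₂ , split , run , run′) =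
      X₁ , X₂ , split , ⊨DDL-mono-target τ Y⊆Y′ run , ⊨DDL-mono-target τ′ Y⊆Y′ run′
    ⊨DDL-mono-target (τ ∩ τ′) Y⊆Y′ (run , run′) =
      ⊨DDL-mono-target τ Y⊆Y′ run , ⊨DDL-mono-target τ′ Y⊆Y′ run′
    ⊨DDL-mono-target (τ ⨾ τ′) Y⊆Y′ (Z , run , run′) = Z , run , ⊨DDL-mono-target τ′ Y⊆Y′ run′

    ⊨DDL-antimono-source : ∀ τ {X X′ Y} → X′ ⊆ X → X ⟶ Y ⊨DDL τ → X′ ⟶ Y ⊨DDL τ
    ⊨DDL-antimono-source (rel R ts)  X′⊆X (lift (holds , X⊆Y)) =
      lift ((λ s x → holds s (X′⊆X s x)) , λ s x → X⊆Y s (X′⊆X s x))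
    ⊨DDL-antimono-source (nrel R ts) X′⊆X (lift (holds , X⊆Y)) =
      lift ((λ s x → holds s (X′⊆X s x)) , λ s x → X⊆Y s (X′⊆X s x))
    ⊨DDL-antimono-source (dep ts t)  X′⊆X (lift (X⊆Y , holds)) =
      lift ((λ s x → X⊆Y s (X′⊆X s x)) , λ s s′ x x′ → holds s s′ (X′⊆X s x) (X′⊆X s′ x′))
    ⊨DDL-antimono-source (ex v)      X′⊆X (lift (F , XF⊆Y)) =
      lift (F , λ { t (s , x , t≡) → XF⊆Y t (s , X′⊆X s x , t≡) })
    ⊨DDL-antimono-source (all v)     X′⊆X (lift XM⊆Y) =
      lift (λ { t (s , m , x , t≡) → XM⊆Y t (s , m , X′⊆X s x , t≡) })
    ⊨DDL-antimono-source (τ ⊗ τ′) {X′ = X′} X′⊆X (X₁ , X₂ , lift (X⊆X₁∪X₂ , _ , _) , run , run′) =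
      (λ s → X′ s × X₁ s) , (λ s → X′ s × X₂ s) ,
      lift ((λ s x → Sum.map (x ,_) (x ,_) (X⊆X₁∪X₂ s (X′⊆X s x))) , (λ _ → proj₁) , (λ _ → proj₁)) ,
      ⊨DDL-antimono-source τ (λ _ → proj₂) run , ⊨DDL-antimono-source τ′ (λ _ → proj₂) run′
    ⊨DDL-antimono-source (τ ∩ τ′) X′⊆X (run , run′) =
      ⊨DDL-antimono-source τ X′⊆X run , ⊨DDL-antimono-source τ′ X′⊆X run′
    ⊨DDL-antimono-source (τ ⨾ τ′) X′⊆X (Z , run , run′) = Z , ⊨DDL-antimono-source τ X′⊆X run , run′

    toDDL-sound : ∀ φ {X} → X ⊨DL φ → X ⊨DDL toDDL φ
    toDDL-sound (rel R ts)  (lift holds) = _ , lift (holds , ⊆-refl)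
    toDDL-sound (nrel R ts) (lift holds) = _ , lift (holds , ⊆-refl)
    toDDL-sound (dep ts t)  (lift holds) = _ , lift (⊆-refl , holds)
    toDDL-sound (φ ∨ ψ) (Y₁ , Y₂ , split , sat , sat′)
      with toDDL-sound φ sat | toDDL-sound ψ sat′
    ... | Z , run | Z′ , run′ =
      (λ s → Z s ⊎ Z′ s) , Y₁ , Y₂ , split ,
      ⊨DDL-mono-target (toDDL φ) (λ _ → inj₁) run , ⊨DDL-mono-target (toDDL ψ) (λ _ → inj₂) run′
    toDDL-sound (φ ∧ ψ) (sat , sat′)
      with toDDL-sound φ sat | toDDL-sound ψ sat′
    ... | Z , run | Z′ , run′ =
      (λ s → Z s ⊎ Z′ s) ,
      ⊨DDL-mono-target (toDDL φ) (λ _ → inj₁) run , ⊨DDL-mono-target (toDDL ψ) (λ _ → inj₂) run′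
    toDDL-sound (ex v φ) {X} (F , sat) with toDDL-sound φ sat
    ... | Y , run = Y , supplement X F v , lift (F , ⊆-refl) , run
    toDDL-sound (all v φ) {X} sat with toDDL-sound φ sat
    ... | Y , run = Y , duplicate X v , lift ⊆-refl , run

    toDDL-complete : ∀ φ {X} → X ⊨DDL toDDL φ → X ⊨DL φ
    toDDL-complete (rel R ts)  (_ , lift (holds , _)) = lift holds
    toDDL-complete (nrel R ts) (_ , lift (holds , _)) = lift holds
    toDDL-complete (dep ts t)  (_ , lift (_ , holds)) = lift holds
    toDDL-complete (φ ∨ ψ) (Y , X₁ , X₂ , split , run , run′) =
      X₁ , X₂ , split , toDDL-complete φ (Y , run) , toDDL-complete ψ (Y , run′)
    toDDL-complete (φ ∧ ψ) (Y , run , run′) =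
      toDDL-complete φ (Y , run) , toDDL-complete ψ (Y , run′)
    toDDL-complete (ex v φ) (Y , Z , lift (F , XF⊆Z) , run) =
      F , toDDL-complete φ (Y , ⊨DDL-antimono-source (toDDL φ) XF⊆Z run)
    toDDL-complete (all v φ) (Y , Z , lift XM⊆Z , run) =
      toDDL-complete φ (Y , ⊨DDL-antimono-source (toDDL φ) XM⊆Z run)

mainTheorem8 : (σ : Signature) → (φ : Syntax.DL σ) →
    Σ (Syntax.DDL σ) λ φ' →
    (M : Structure σ) → (X : Semantics.Team M) →
    (Semantics._⊨DL_ M X φ ⇔ Semantics._⊨DDL_ M X φ')
    × (Semantics._⊨DDL_ M X φ' ⇔ Σ (Semantics.Team M) λ Y → Semantics._⟶_⊨DDL_ M X Y φ')
mainTheorem8 σ φ = toDDL φ , λ M X →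
  mk⇔ (toDDL-sound M φ) (toDDL-complete M φ) , ⇔.refl
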